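{- Let $\mathcal{L}$ be a lattice-oriented signature, let $\mathbf{A}$ be any complete $\mathcal{L}$-lattice and let $W$ be any set. Let $\mathbf{A}^W$ be the $\mathcal{L}$-lattice of all functions $W\to A$ with operations defined pointwise, and define for $f\in A^W$ and $u\in W$: $\Box f(u)=\bigwedge_{v\in W}f(v)$ and $\Diamond f(u)=\bigvee_{v\in W}f(v)$. Then $\langle\mathbf{A}^W,\Box,\Diamond\rangle$ is an m-$\mathcal{L}$-lattice. Moreover, if $\mathbf{A}\in\mathsf{V}$ for some variety $\mathsf{V}$ of $\mathcal{L}$-lattices, then $\langle\mathbf{A}^W,\Box,\Diamond\rangle\in m\mathsf{V}$.
   Context: A signature $\mathcal{L}$ is lattice-oriented if its set of binary operation symbols contains distinct symbols $\land$ and $\lor$. An $\mathcal{L}$-lattice is an algebra of signature $\mathcal{L}$ whose $\{\land,\lor\}$-reduct is a lattice; it is complete if this lattice is complete. An m-$\mathcal{L}$-lattice is a structure $\langle\mathbf{A},\Box,\Diamond\rangle$ where $\mathbf{A}$ is an $\mathcal{L}$-lattice and $\Box,\Diamond$ are unary operations satisfying $\Box x\land x\approx\Box x$, $\Diamond x\lor x\approx \Diamond x$, $\Box(x\land y)\approx\Box x\land\Box y$, $\Diamond(x\lor y)\approx\Diamond x\lor\Diamond y$, $\Box\Diamond x\approx\Diamond x$, $\Diamond\Box x\approx\Box x$, and, for every $n$-ary $\star\in\mathcal{L}$, $\Box(\star(\Box x_1,\dots,\Box x_n))\approx\star(\Box x_1,\dots,\Box x_n)$. For a class $\mathsf{K}$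 of $\mathcal{L}$-lattices, $m\mathsf{K}$ is the class of m-$\mathcal{L}$-lattices $\langle\mathbf{A},\Box,\Diamond\rangle$ with $\mathbf{A}\in\mathsf{K}$. -}

module Defs where

open import Level using (Level; _⊔_) renaming (suc to lsuc)
open import Data.Nat using (ℕ)
open import Data.Fin using (Fin; zero; suc)
open import Data.Product using (Σ; _×_; _,_; proj₁)
open import Relation.Nullary using (¬_)
open import Relation.Binary.PropositionalEquality using (_≡_; subst)
open import Relation.Binary.Structures using (IsEquivalence)
open import Algebra.Lattice.Structures using (IsLattice)

record Signature : Set₁ where
  field
    OpSym   : Set
    arity   : OpSym → ℕ
    meet    : OpSym
    join    : OpSym
    meet-ar : arity meet ≡ 2
    join-ar : arity join ≡ 2
    meet≢join : ¬ (meet ≡ join)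
open Signature public

pair : ∀ {a} {A : Set a} → A → A → Fin 2 → A
pair x y zero = x
pair x y (suc _) = y

record Algebra (L : Signature) (a ℓ : Level) : Set (lsuc (a ⊔ ℓ)) where
  field
    Carrier : Set a
    _≈_     : Carrier → Carrier → Set ℓ
    isEquivalence : IsEquivalence _≈_
    op      : (f : OpSym L) → (Fin (arity L f) → Carrier) → Carrier
    op-cong : (f : OpSym L) (xs ys : Fin (arity L f) → Carrier) →
              (∀ i → xs i ≈ ys i) → op f xs ≈ op f ys

  infixr 7 _∧_
  infixr 6 _∨_
  _∧_ : Carrier → Carrier → Carrier
  x ∧ y = op (meet L) (λ i → pair x y (subst Fin (meet-ar L) i))
  _∨_ : Carrier → Carrier → Carrier
  x ∨ y = op (join L) (λ i → pair x y (subst Fin (join-ar L) i))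

  _≤_ : Carrier → Carrier → Set ℓ
  x ≤ y = (x ∧ y) ≈ x
open Algebra public

IsLLattice : ∀ {L a ℓ} → Algebra L a ℓ → Set (a ⊔ ℓ)
IsLLattice A = IsLattice (_≈_ A) (_∨_ A) (_∧_ A)

IsInfimum : ∀ {L a ℓ ι} (A : Algebra L a ℓ) {I : Set ι} → (I → Carrier A) → Carrier A → Set (a ⊔ ℓ ⊔ ι)
IsInfimum A {I} g m = (∀ i → _≤_ A m (g i)) × (∀ c → (∀ i → _≤_ A c (g i)) → _≤_ A c m)

IsSupremum : ∀ {L a ℓ ι} (A : Algebra L a ℓ) {I : Set ι} → (I → Carrier A) → Carrier A → Set (a ⊔ ℓ ⊔ ι)
IsSupremum A {I} g m = (∀ i → _≤_ A (g i) m) × (∀ c → (∀ i → _≤_ A (g i) c) → _≤_ A m c)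

IsComplete : ∀ {L a ℓ} (ι : Level) → Algebra L a ℓ → Set (a ⊔ ℓ ⊔ lsuc ι)
IsComplete ι A = (I : Set ι) (g : I → Carrier A) →
  Σ (Carrier A) (IsInfimum A g) × Σ (Carrier A) (IsSupremum A g)

⋀ : ∀ {L a ℓ ι} (A : Algebra L a ℓ) → IsComplete ι A → {I : Set ι} → (I → Carrier A) → Carrier A
⋀ A c {I} g = proj₁ (proj₁ (c I g))

⋁ : ∀ {L a ℓ ι} (A : Algebra L a ℓ) → IsComplete ι A → {I : Set ι} → (I → Carrier A) → Carrier A
⋁ A c {I} g = proj₁ (Data.Product.proj₂ (c I g))

_^_ : ∀ {L a ℓ ι} → Algebra L a ℓ → Set ι → Algebra L (ι ⊔ a) (ι ⊔ ℓ)
A ^ W = record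
  { Carrier = W → Carrier A
  ; _≈_ = λ f g → ∀ w → _≈_ A (f w) (g w)
  ; isEquivalence = record
      { refl  = λ w → IsEquivalence.refl (isEquivalence A)
      ; sym   = λ p w → IsEquivalence.sym (isEquivalence A) (p w)
      ; trans = λ p q w → IsEquivalence.trans (isEquivalence A) (p w) (q w)
      }
  ; op = λ f xs w → op A f (λ i → xs i w)
  ; op-cong = λ f xs ys p w → op-cong A f (λ i → xs i w) (λ i → ys i w) (λ i → p i w)
  }

□ᵂ : ∀ {L a ℓ ι} (A : Algebra L a ℓ) (c : IsComplete ι A) (W : Set ι) → (W → Carrier A) → (W → Carrier A)
□ᵂ A c W f u = ⋀ A c f

◇ᵂ : ∀ {L a ℓ ι} (A : Algebra L a ℓ) (c : IsComplete ι A) (W : Set ι) → (W → Carrier A) → (W → Carrier A)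
◇ᵂ A c W f u = ⋁ A c f

record IsMLLattice {L a ℓ} (A : Algebra L a ℓ) (□ ◇ : Carrier A → Carrier A) : Set (a ⊔ ℓ) where
  open Algebra A using () renaming (_≈_ to _≈ₐ_; _∧_ to _∧ₐ_; _∨_ to _∨ₐ_)
  field
    isLLattice : IsLLattice A
    □-cong  : ∀ x y → x ≈ₐ y → □ x ≈ₐ □ y
    ◇-cong  : ∀ x y → x ≈ₐ y → ◇ x ≈ₐ ◇ y
    □-defl  : ∀ x → (□ x ∧ₐ x) ≈ₐ □ x
    ◇-infl  : ∀ x → (◇ x ∨ₐ x) ≈ₐ ◇ x
    □-∧     : ∀ x y → □ (x ∧ₐ y) ≈ₐ (□ x ∧ₐ □ y)
    ◇-∨     : ∀ x y → ◇ (x ∨ₐ y) ≈ₐ (◇ x ∨ₐ ◇ y)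
    □◇      : ∀ x → □ (◇ x) ≈ₐ ◇ x
    ◇□      : ∀ x → ◇ (□ x) ≈ₐ □ x
    □-op    : (f : OpSym L) (xs : Fin (arity L f) → Carrier A) →
              □ (op A f (λ i → □ (xs i))) ≈ₐ op A f (λ i → □ (xs i))

data Term (L : Signature) (X : Set) : Set where
  var : X → Term L X
  app : (f : OpSym L) → (Fin (arity L f) → Term L X) → Term L X

eval : ∀ {L a ℓ} (A : Algebra L a ℓ) {X : Set} → (X → Carrier A) → Term L X → Carrier A
eval A ρ (var x) = ρ x
eval A ρ (app f ts) = op A f (λ i → eval A ρ (ts i))

Equation : Signature → Set
Equation L = Term L ℕ × Term L ℕ

_⊨_ : ∀ {L a ℓ} → Algebra L a ℓ → Equation L → Set (a ⊔ ℓ)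
A ⊨ (s , t) = (ρ : ℕ → Carrier A) → _≈_ A (eval A ρ s) (eval A ρ t)

-- A variety V of L-lattices, presented by a set of identities E (indexed by J):
-- V = the class of L-lattices satisfying every identity in E.
InVariety : ∀ {L a ℓ} {J : Set} → (J → Equation L) → Algebra L a ℓ → Set (a ⊔ ℓ)
InVariety E A = IsLLattice A × (∀ j → A ⊨ E j)

InMVariety : ∀ {L a ℓ} {J : Set} → (J → Equation L) →
             (A : Algebra L a ℓ) → (Carrier A → Carrier A) → (Carrier A → Carrier A) → Set (a ⊔ ℓ)
InMVariety E A □ ◇ = IsMLLattice A □ ◇ × InVariety E A

-- Operations of A^W, and hence the evaluation of terms, are computed pointwise, so A^W
-- is a lattice satisfying every identity of A. Since □f and ◇f are constant functions,
-- the laws □◇x ≈ ◇x, ◇□x ≈ □x and □(op(□x₁,…,□xₙ)) ≈ op(□x₁,…,□xₙ) reduce to the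
-- infimum (supremum) of a constant family being that constant, which needs W nonempty:
-- it is inhabited by the point at which the law is checked. □(f ∧ g) ≈ □f ∧ □g holds
-- because the meet of two infima is an infimum of the pointwise meet and infima are
-- unique; dually for ◇.
module Submission where

open import Defs hiding (_≈_; _∧_; _∨_; _≤_)
open import Level using (Level)
open import Data.Fin using (Fin; zero; suc)
open import Data.Product using (_×_; _,_; proj₁; proj₂)
open import Relation.Binary.PropositionalEquality using (subst)
open import Relation.Binary.Structures using (IsEquivalence)
open import Algebra.Lattice.Bundles using (Lattice)
open import Algebra.Lattice.Structures using (IsLattice)
import Algebra.Lattice.Properties.Lattice as LatticeProperties
import Relation.Binary.Lattice as OrderTheoretic

module LatticeOrder {L : Signature} {a ℓ : Level} (A : Algebra L a ℓ) (isL : IsLLattice A) where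
  open Algebra A using (_≈_; _∧_; _∨_; _≤_)
  open IsLattice isL using (refl; sym)

  private
    lattice : Lattice a ℓ
    lattice = record { isLattice = isL }

    -- The standard library orders a lattice by x ≈ x ∧ y, the symmetric form of _≤_.
    module O = OrderTheoretic.Lattice (LatticeProperties.∨-∧-orderTheoreticLattice lattice)

  ≤-refl : ∀ {x} → x ≤ x
  ≤-refl = sym O.refl

  ≤-reflexive : ∀ {x y} → x ≈ y → x ≤ y
  ≤-reflexive x≈y = sym (O.reflexive x≈y)

  ≤-trans : ∀ {x y z} → x ≤ y → y ≤ z → x ≤ z
  ≤-trans x≤y y≤z = sym (O.trans (sym x≤y) (sym y≤z))

  ≤-antisym : ∀ {x y} → x ≤ y → y ≤ x → x ≈ y
  ≤-antisym x≤y y≤x = O.antisym (sym x≤y) (sym y≤x)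

  x∧y≤x : ∀ x y → (x ∧ y) ≤ x
  x∧y≤x x y = sym (O.x∧y≤x x y)

  x∧y≤y : ∀ x y → (x ∧ y) ≤ y
  x∧y≤y x y = sym (O.x∧y≤y x y)

  ∧-greatest : ∀ {x y z} → x ≤ y → x ≤ z → x ≤ (y ∧ z)
  ∧-greatest x≤y x≤z = sym (O.∧-greatest (sym x≤y) (sym x≤z))

  x≤x∨y : ∀ x y → x ≤ (x ∨ y)
  x≤x∨y x y = sym (O.x≤x∨y x y)

  y≤x∨y : ∀ x y → y ≤ (x ∨ y)
  y≤x∨y x y = sym (O.y≤x∨y x y)

  ∨-least : ∀ {x y z} → x ≤ z → y ≤ z → (x ∨ y) ≤ z
  ∨-least x≤z y≤z = sym (O.∨-least (sym x≤z) (sym y≤z))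

  ∧-mono-≤ : ∀ {x y u v} → x ≤ y → u ≤ v → (x ∧ u) ≤ (y ∧ v)
  ∧-mono-≤ x≤y u≤v = ∧-greatest (≤-trans (x∧y≤x _ _) x≤y) (≤-trans (x∧y≤y _ _) u≤v)

  ∨-mono-≤ : ∀ {x y u v} → x ≤ y → u ≤ v → (x ∨ u) ≤ (y ∨ v)
  ∨-mono-≤ x≤y u≤v = ∨-least (≤-trans x≤y (x≤x∨y _ _)) (≤-trans u≤v (y≤x∨y _ _))

  module _ {ι : Level} {I : Set ι} where

    infimum-cong : ∀ {g h : I → Carrier A} {m n} → (∀ i → g i ≈ h i) →
                   IsInfimum A g m → IsInfimum A h n → m ≈ n
    infimum-cong g≈h (m≤g , m-glb) (n≤h , n-glb) = ≤-antisym
      (n-glb _ λ i → ≤-trans (m≤g i) (≤-reflexive (g≈h i)))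
      (m-glb _ λ i → ≤-trans (n≤h i) (≤-reflexive (sym (g≈h i))))

    supremum-cong : ∀ {g h : I → Carrier A} {m n} → (∀ i → g i ≈ h i) →
                    IsSupremum A g m → IsSupremum A h n → m ≈ n
    supremum-cong g≈h (g≤m , m-lub) (h≤n , n-lub) = ≤-antisym
      (m-lub _ λ i → ≤-trans (≤-reflexive (g≈h i)) (h≤n i))
      (n-lub _ λ i → ≤-trans (≤-reflexive (sym (g≈h i))) (g≤m i))

    infimum-const : ∀ {k m} → I → IsInfimum A (λ _ → k) m → m ≈ k
    infimum-const i (m≤k , m-glb) = ≤-antisym (m≤k i) (m-glb _ λ _ → ≤-refl)

    supremum-const : ∀ {k m} → I → IsSupremum A (λ _ → k) m → m ≈ k
    supremum-const i (k≤m , m-lub) = ≤-antisym (m-lub _ λ _ → ≤-refl) (k≤m i)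

    infimum-∧ : ∀ {g h : I → Carrier A} {m n} → IsInfimum A g m → IsInfimum A h n →
                IsInfimum A (λ i → g i ∧ h i) (m ∧ n)
    infimum-∧ (m≤g , m-glb) (n≤h , n-glb) =
      (λ i → ∧-mono-≤ (m≤g i) (n≤h i)) ,
      (λ c c≤g∧h → ∧-greatest (m-glb c λ i → ≤-trans (c≤g∧h i) (x∧y≤x _ _))
                              (n-glb c λ i → ≤-trans (c≤g∧h i) (x∧y≤y _ _)))

    supremum-∨ : ∀ {g h : I → Carrier A} {m n} → IsSupremum A g m → IsSupremum A h n →
                 IsSupremum A (λ i → g i ∨ h i) (m ∨ n)
    supremum-∨ (g≤m , m-lub) (h≤n , n-lub) =
      (λ i → ∨-mono-≤ (g≤m i) (h≤n i)) ,
      (λ c g∨h≤c → ∨-least (m-lub c λ i → ≤-trans (x≤x∨y _ _) (g∨h≤c i))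
                           (n-lub c λ i → ≤-trans (y≤x∨y _ _) (g∨h≤c i)))

module Power {L : Signature} {a ℓ ι : Level} (A : Algebra L a ℓ) (W : Set ι) where
  open Algebra A using (_≈_; _∧_; _∨_)
  open IsEquivalence (isEquivalence A)
  open Algebra (A ^ W) using () renaming (_≈_ to _≈ᵂ_; _∧_ to _∧ᵂ_; _∨_ to _∨ᵂ_)

  pair-pointwise : ∀ (f g : W → Carrier A) w j → pair f g j w ≈ pair (f w) (g w) j
  pair-pointwise f g w zero    = refl
  pair-pointwise f g w (suc _) = refl

  ∧ᵂ-pointwise : ∀ f g w → (f ∧ᵂ g) w ≈ (f w ∧ g w)
  ∧ᵂ-pointwise f g w = op-cong A (meet L) _ _ λ i → pair-pointwise f g w (subst Fin (meet-ar L) i)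

  ∨ᵂ-pointwise : ∀ f g w → (f ∨ᵂ g) w ≈ (f w ∨ g w)
  ∨ᵂ-pointwise f g w = op-cong A (join L) _ _ λ i → pair-pointwise f g w (subst Fin (join-ar L) i)

  eval-pointwise : ∀ {X : Set} (ρ : X → W → Carrier A) t w →
                   eval (A ^ W) ρ t w ≈ eval A (λ x → ρ x w) t
  eval-pointwise ρ (var x)    w = refl
  eval-pointwise ρ (app f ts) w = op-cong A f _ _ λ i → eval-pointwise ρ (ts i) w

  ^-satisfies : ∀ e → A ⊨ e → (A ^ W) ⊨ e
  ^-satisfies (s , t) A⊨e ρ w =
    trans (eval-pointwise ρ s w) (trans (A⊨e λ x → ρ x w) (sym (eval-pointwise ρ t w)))

  ≈ᵂ-via : ∀ {f g l r : W → Carrier A} →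
           (∀ w → f w ≈ l w) → (∀ w → l w ≈ r w) → (∀ w → g w ≈ r w) → f ≈ᵂ g
  ≈ᵂ-via f≈l l≈r g≈r w = trans (f≈l w) (trans (l≈r w) (sym (g≈r w)))

  module _ (isL : IsLLattice A) where
    open IsLattice isL using (∧-comm; ∨-comm; ∧-assoc; ∨-assoc; ∧-cong; ∨-cong; ∨-absorbs-∧; ∧-absorbs-∨)

    ∧ᵂ-pointwiseˡ : ∀ f g h w → ((f ∧ᵂ g) ∧ᵂ h) w ≈ ((f w ∧ g w) ∧ h w)
    ∧ᵂ-pointwiseˡ f g h w = trans (∧ᵂ-pointwise _ h w) (∧-cong (∧ᵂ-pointwise f g w) refl)

    ∧ᵂ-pointwiseʳ : ∀ f g h w → (f ∧ᵂ (g ∧ᵂ h)) w ≈ (f w ∧ (g w ∧ h w))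
    ∧ᵂ-pointwiseʳ f g h w = trans (∧ᵂ-pointwise f _ w) (∧-cong refl (∧ᵂ-pointwise g h w))

    ∨ᵂ-pointwiseˡ : ∀ f g h w → ((f ∨ᵂ g) ∨ᵂ h) w ≈ ((f w ∨ g w) ∨ h w)
    ∨ᵂ-pointwiseˡ f g h w = trans (∨ᵂ-pointwise _ h w) (∨-cong (∨ᵂ-pointwise f g w) refl)

    ∨ᵂ-pointwiseʳ : ∀ f g h w → (f ∨ᵂ (g ∨ᵂ h)) w ≈ (f w ∨ (g w ∨ h w))
    ∨ᵂ-pointwiseʳ f g h w = trans (∨ᵂ-pointwise f _ w) (∨-cong refl (∨ᵂ-pointwise g h w))

    ^-isLLattice : IsLLattice (A ^ W)
    ^-isLLattice = record
      { isEquivalence = isEquivalence (A ^ W)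
      ; ∨-comm  = λ f g → ≈ᵂ-via (∨ᵂ-pointwise f g) (λ w → ∨-comm _ _) (∨ᵂ-pointwise g f)
      ; ∨-assoc = λ f g h → ≈ᵂ-via (∨ᵂ-pointwiseˡ f g h) (λ w → ∨-assoc _ _ _) (∨ᵂ-pointwiseʳ f g h)
      ; ∨-cong  = λ {f} {f′} {g} {g′} f≈f′ g≈g′ →
          ≈ᵂ-via (∨ᵂ-pointwise f g) (λ w → ∨-cong (f≈f′ w) (g≈g′ w)) (∨ᵂ-pointwise f′ g′)
      ; ∧-comm  = λ f g → ≈ᵂ-via (∧ᵂ-pointwise f g) (λ w → ∧-comm _ _) (∧ᵂ-pointwise g f)
      ; ∧-assoc = λ f g h → ≈ᵂ-via (∧ᵂ-pointwiseˡ f g h) (λ w → ∧-assoc _ _ _) (∧ᵂ-pointwiseʳ f g h)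
      ; ∧-cong  = λ {f} {f′} {g} {g′} f≈f′ g≈g′ →
          ≈ᵂ-via (∧ᵂ-pointwise f g) (λ w → ∧-cong (f≈f′ w) (g≈g′ w)) (∧ᵂ-pointwise f′ g′)
      ; absorptive =
          (λ f g w → trans (∨ᵂ-pointwise f _ w) (trans (∨-cong refl (∧ᵂ-pointwise f g w)) (∨-absorbs-∧ _ _))) ,
          (λ f g w → trans (∧ᵂ-pointwise f _ w) (trans (∧-cong refl (∨ᵂ-pointwise f g w)) (∧-absorbs-∨ _ _)))
      }

module PowerModal {L : Signature} {a ℓ ι : Level} (A : Algebra L a ℓ) (isL : IsLLattice A)
                  (c : IsComplete ι A) (W : Set ι) where
  open IsEquivalence (isEquivalence A)
  open LatticeOrder A isL
  open Power A W

  ⋀-isInfimum : (f : W → Carrier A) → IsInfimum A f (⋀ A c f)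
  ⋀-isInfimum f = proj₂ (proj₁ (c W f))

  ⋁-isSupremum : (f : W → Carrier A) → IsSupremum A f (⋁ A c f)
  ⋁-isSupremum f = proj₂ (proj₂ (c W f))

  ^-isMLLattice : IsMLLattice (A ^ W) (□ᵂ A c W) (◇ᵂ A c W)
  ^-isMLLattice = record
    { isLLattice = ^-isLLattice isL
    ; □-cong = λ f g f≈g u → infimum-cong f≈g (⋀-isInfimum f) (⋀-isInfimum g)
    ; ◇-cong = λ f g f≈g u → supremum-cong f≈g (⋁-isSupremum f) (⋁-isSupremum g)
    ; □-defl = λ f u → trans (∧ᵂ-pointwise _ f u) (proj₁ (⋀-isInfimum f) u)
    ; ◇-infl = λ f u → trans (∨ᵂ-pointwise _ f u)
        (≤-antisym (∨-least ≤-refl (proj₁ (⋁-isSupremum f) u)) (x≤x∨y _ _))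
    ; □-∧ = λ f g u → trans
        (infimum-cong (∧ᵂ-pointwise f g) (⋀-isInfimum _) (infimum-∧ (⋀-isInfimum f) (⋀-isInfimum g)))
        (sym (∧ᵂ-pointwise _ _ u))
    ; ◇-∨ = λ f g u → trans
        (supremum-cong (∨ᵂ-pointwise f g) (⋁-isSupremum _) (supremum-∨ (⋁-isSupremum f) (⋁-isSupremum g)))
        (sym (∨ᵂ-pointwise _ _ u))
    ; □◇ = λ f u → infimum-const u (⋀-isInfimum _)
    ; ◇□ = λ f u → supremum-const u (⋁-isSupremum _)
    ; □-op = λ f xs u → infimum-const u (⋀-isInfimum _)
    }

proposition3p5 : ∀ {a ℓ ι : Level} (L : Signature) (A : Algebra L a ℓ) →
    IsLLattice A → (c : IsComplete ι A) → (W : Set ι) →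
    IsMLLattice (A ^ W) (□ᵂ A c W) (◇ᵂ A c W)
    × (∀ {J : Set} (E : J → Equation L) → InVariety E A →
         InMVariety E (A ^ W) (□ᵂ A c W) (◇ᵂ A c W))
proposition3p5 L A isL c W =
  ^-isMLLattice , λ E (_ , A⊨E) → ^-isMLLattice , ^-isLLattice isL , λ j → ^-satisfies (E j) (A⊨E j)
  where
  open Power A W using (^-isLLattice; ^-satisfies)
  open PowerModal A isL c W using (^-isMLLattice)
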